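{- Suppose that $u \geq 1$, $s$, $t$ are integers, $n=2 \cdot 3^u$, $1 \leq s, t \leq n/2$, $3 \mid s$, $2 \nmid s$, $3 \nmid t$, and $2 \mid t$. Then $\chi(C_n, \{s,t\})=3$.
   Context: $C_n$ is the cycle with vertex set $\mathbb{Z}_n=\{0,1,\dots,n-1\}$, $i$ adjacent to $i\pm1 \pmod n$; the graph distance is $\mathrm{dist}(i,j)=\min(|i-j|,\,n-|i-j|)$. For a set $D$ of positive integers, the distance graph $G(C_n,D)$ has vertex set $\mathbb{Z}_n$, with distinct $i,j$ adjacent iff $\mathrm{dist}(i,j)\in D$; $\chi(C_n,D)$ is its chromatic number. -}

module Defs where

open import Data.Nat using (ℕ; _⊓_; _∸_; _<_; ∣_-_∣)
open import Data.Fin using (Fin; toℕ)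
open import Data.List using (List)
open import Data.List.Membership.Propositional using (_∈_)
open import Data.Product using (∃)
open import Relation.Binary.PropositionalEquality using (_≡_)
open import Relation.Nullary using (¬_)

cycDist : (n : ℕ) → Fin n → Fin n → ℕ
cycDist n i j = ∣ toℕ i - toℕ j ∣ ⊓ (n ∸ ∣ toℕ i - toℕ j ∣)

Adj : (n : ℕ) → List ℕ → Fin n → Fin n → Set
Adj n D i j = (¬ i ≡ j) × (cycDist n i j ∈ D)
  where open import Data.Product using (_×_)

ProperColouring : (n : ℕ) → List ℕ → (k : ℕ) → (Fin n → Fin k) → Set
ProperColouring n D k c = ∀ i j → Adj n D i j → ¬ c i ≡ c j

Colourable : (n : ℕ) → List ℕ → ℕ → Set
Colourable n D k = ∃ λ (c : Fin n → Fin k) → ProperColouring n D k c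

ChromaticNumber : (n : ℕ) → List ℕ → ℕ → Set
ChromaticNumber n D k = Colourable n D k × (∀ m → m < k → ¬ Colourable n D m)
  where open import Data.Product using (_×_)

-- Colour i by ⌊(i mod 6)/2⌋.  Since 6 ∣ n, an edge of length s or t joins vertices whose
-- residues mod 6 differ by ±s ≡ 3 or ±t ≡ ±2, while vertices of equal colour differ by
-- 0 or ±1 mod 6; so three colours suffice.  Two do not: from 0, t steps of length s and
-- s steps of length t both reach st, and in a 2-colouring every step swaps the colour,
-- which is impossible as s is odd and t even.
module Submission where

open import Defs
open import Data.Nat using (ℕ; _≤_; _*_; _^_)
open import Data.Nat.Divisibility using (_∣_)
open import Data.List using (_∷_; [])
open import Relation.Nullary using (¬_)

open import Data.Nat using (suc; _+_; _∸_; _<_; _⊓_; ∣_-_∣; NonZero; _%_; s≤s; s≤s⁻¹; _<?_)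
open import Data.Nat.Properties
open import Data.Nat.DivMod
open import Data.Nat.Divisibility using (divides; n∣m⇒m%n≡0; m%n≡0⇒n∣m)
open import Data.Nat.Tactic.RingSolver using (solve)
open import Data.Fin using (Fin; toℕ; inject≤; quotient; zero; suc)
open import Data.Fin.Properties using (toℕ-fromℕ<; fromℕ<-cong; toℕ<n; inject≤-injective)
open import Data.List.Membership.Propositional using (_∈_)
open import Data.List.Relation.Unary.Any using (here; there)
open import Data.Product using (_,_)
open import Data.Sum using (_⊎_; inj₁; inj₂; swap)
open import Relation.Binary.PropositionalEquality
open import Function using (_∘_)
open import Relation.Nullary using (yes; no; contradiction)

shorterArc : ℕ → ℕ → ℕ
shorterArc n d = d ⊓ (n ∸ d)

data Step (n e x y : ℕ) : Set where
  plain   : x + e ≡ y     → Step n e x y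
  wrapped : x + e ≡ y + n → Step n e x y

shorterArc-self : ∀ {n e} → e + e ≤ n → shorterArc n e ≡ e
shorterArc-self {e = e} e+e≤n = m≤n⇒m⊓n≡m (m+n≤o⇒m≤o∸n e e+e≤n)

shorterArc-complement : ∀ {n e} → e + e ≤ n → shorterArc n (n ∸ e) ≡ e
shorterArc-complement {n} {e} e+e≤n = begin
  (n ∸ e) ⊓ (n ∸ (n ∸ e)) ≡⟨ cong ((n ∸ e) ⊓_) (m∸[m∸n]≡n (≤-trans (m≤m+n e e) e+e≤n)) ⟩
  (n ∸ e) ⊓ e             ≡⟨ m≥n⇒m⊓n≡n (m+n≤o⇒m≤o∸n e e+e≤n) ⟩
  e                       ∎
  where open ≡-Reasoning

shorterArc-cases : ∀ {n d e} → d ≤ n → shorterArc n d ≡ e → d ≡ e ⊎ d + e ≡ n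
shorterArc-cases {n} {d} {e} d≤n arc≡e with ⊓-sel d (n ∸ d)
... | inj₁ arc≡d   = inj₁ (trans (sym arc≡d) arc≡e)
... | inj₂ arc≡n∸d = inj₂ (begin
  d + e       ≡⟨ cong (d +_) (trans (sym arc≡e) arc≡n∸d) ⟩
  d + (n ∸ d) ≡⟨ m+[n∸m]≡n d≤n ⟩
  n           ∎)
  where open ≡-Reasoning

Step⇒shorterArc : ∀ {n e x y} → e + e ≤ n → Step n e x y → shorterArc n ∣ x - y ∣ ≡ e
Step⇒shorterArc {x = x} e+e≤n (plain refl) =
  trans (cong (shorterArc _) (∣m-m+n∣≡n x _)) (shorterArc-self e+e≤n)
Step⇒shorterArc {n} {e} {x} {y} e+e≤n (wrapped x+e≡y+n) =
  trans (cong (shorterArc n) ∣x-y∣≡n∸e) (shorterArc-complement e+e≤n)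
  where
  open ≡-Reasoning
  e≤n : e ≤ n
  e≤n = ≤-trans (m≤m+n e e) e+e≤n
  x≡y+[n∸e] : x ≡ y + (n ∸ e)
  x≡y+[n∸e] = +-cancelʳ-≡ e x (y + (n ∸ e)) (begin
    x + e             ≡⟨ x+e≡y+n ⟩
    y + n             ≡⟨ cong (y +_) (m∸n+n≡m e≤n) ⟨
    y + (n ∸ e + e)   ≡⟨ +-assoc y (n ∸ e) e ⟨
    y + (n ∸ e) + e   ∎)
  ∣x-y∣≡n∸e : ∣ x - y ∣ ≡ n ∸ e
  ∣x-y∣≡n∸e = begin
    ∣ x - y ∣             ≡⟨ ∣-∣-comm x y ⟩
    ∣ y - x ∣             ≡⟨ cong ∣ y -_∣ x≡y+[n∸e] ⟩
    ∣ y - y + (n ∸ e) ∣   ≡⟨ ∣m-m+n∣≡n y (n ∸ e) ⟩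
    n ∸ e                 ∎

shorterArc⇒Step : ∀ {n e x y} → x ≤ y → y ≤ n → shorterArc n (y ∸ x) ≡ e →
  Step n e x y ⊎ Step n e y x
shorterArc⇒Step {n} {e} {x} {y} x≤y y≤n arc≡e
  with shorterArc-cases (≤-trans (m∸n≤m y x) y≤n) arc≡e
... | inj₁ y∸x≡e   = inj₁ (plain (trans (cong (x +_) (sym y∸x≡e)) (m+[n∸m]≡n x≤y)))
... | inj₂ y∸x+e≡n = inj₂ (wrapped (begin
  y + e           ≡⟨ cong (_+ e) (m+[n∸m]≡n x≤y) ⟨
  x + (y ∸ x) + e ≡⟨ +-assoc x (y ∸ x) e ⟩
  x + (y ∸ x + e) ≡⟨ cong (x +_) y∸x+e≡n ⟩
  x + n           ∎))
  where open ≡-Reasoning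

cycDist⇒Step : ∀ {n e} (i j : Fin n) → cycDist n i j ≡ e →
  Step n e (toℕ i) (toℕ j) ⊎ Step n e (toℕ j) (toℕ i)
cycDist⇒Step {n} i j dist≡e with ≤-total (toℕ i) (toℕ j)
... | inj₁ i≤j = shorterArc⇒Step i≤j (<⇒≤ (toℕ<n j))
  (trans (cong (shorterArc n) (sym (m≤n⇒∣m-n∣≡n∸m i≤j))) dist≡e)
... | inj₂ j≤i = swap (shorterArc⇒Step j≤i (<⇒≤ (toℕ<n i))
  (trans (cong (shorterArc n) (sym (m≤n⇒∣n-m∣≡n∸m j≤i))) dist≡e))

cycDist-refl : ∀ {n} (i : Fin n) → cycDist n i i ≡ 0
cycDist-refl {n} i = cong (shorterArc n) (∣n-n∣≡0 (toℕ i))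

Step-% : ∀ {n e x} .{{_ : NonZero n}} → x < n → e < n → Step n e x ((x + e) % n)
Step-% {n} {e} {x} x<n e<n with x + e <? n
... | yes x+e<n = plain (sym (m<n⇒m%n≡m x+e<n))
... | no x+e≮n = wrapped (begin
  x + e               ≡⟨ m∸n+n≡m n≤x+e ⟨
  x + e ∸ n + n       ≡⟨ cong (_+ n) (m<n⇒m%n≡m (m<n+o⇒m∸n<o (x + e) n (+-mono-< x<n e<n))) ⟨
  (x + e ∸ n) % n + n ≡⟨ cong (_+ n) (m≤n⇒[n∸m]%m≡n%m n≤x+e) ⟩
  (x + e) % n + n     ∎)
  where
  open ≡-Reasoning
  n≤x+e : n ≤ x + e
  n≤x+e = ≮⇒≥ x+e≮n

Step-mod : ∀ {n e} .{{_ : NonZero n}} → e < n → ∀ k → Step n e (k % n) ((k + e) % n)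
Step-mod {n} {e} e<n k = subst (Step n e (k % n)) (sym [k+e]%n≡[k%n+e]%n) (Step-% (m%n<n k n) e<n)
  where
  [k+e]%n≡[k%n+e]%n : (k + e) % n ≡ (k % n + e) % n
  [k+e]%n≡[k%n+e]%n = trans (%-distribˡ-+ k e n) (cong (λ x → (k % n + x) % n) (m<n⇒m%n≡m e<n))

mod-adjacent : ∀ {n D e} .{{_ : NonZero n}} → e ∈ D → 0 < e → e + e ≤ n →
  ∀ k → Adj n D (k mod n) ((k + e) mod n)
mod-adjacent {n} {D} {e} e∈D 0<e e+e≤n k = distinct , subst (_∈ D) (sym dist≡e) e∈D
  where
  dist≡e : cycDist n (k mod n) ((k + e) mod n) ≡ e
  dist≡e = subst₂ (λ x y → shorterArc n ∣ x - y ∣ ≡ e)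
    (sym (toℕ-fromℕ< (m%n<n k n))) (sym (toℕ-fromℕ< (m%n<n (k + e) n)))
    (Step⇒shorterArc e+e≤n (Step-mod (<-≤-trans (m<m+n e 0<e) e+e≤n) k))
  distinct : k mod n ≢ (k + e) mod n
  distinct eq = <⇒≢ 0<e (trans (sym (cycDist-refl (k mod n)))
    (trans (cong (cycDist n (k mod n)) eq) dist≡e))

≢-≢⇒≡ : {a b c : Fin 2} → a ≢ b → b ≢ c → a ≡ c
≢-≢⇒≡ {zero}     {zero}                 a≢b _   = contradiction refl a≢b
≢-≢⇒≡ {zero}     {suc zero} {zero}      _   _   = refl
≢-≢⇒≡ {zero}     {suc zero} {suc zero}  _   b≢c = contradiction refl b≢c
≢-≢⇒≡ {suc zero} {zero}     {zero}      _   b≢c = contradiction refl b≢c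
≢-≢⇒≡ {suc zero} {zero}     {suc zero}  _   _   = refl
≢-≢⇒≡ {suc zero} {suc zero}             a≢b _   = contradiction refl a≢b

module _ {n D} .{{_ : NonZero n}} {c : Fin n → Fin 2} (proper : ProperColouring n D 2 c)
         {e} (e∈D : e ∈ D) (0<e : 0 < e) (e+e≤n : e + e ≤ n) where

  colour-return : ∀ k → c ((k + (e + e)) mod n) ≡ c (k mod n)
  colour-return k = sym (subst (λ m → c (k mod n) ≡ c (m mod n)) (+-assoc k e e)
    (≢-≢⇒≡ (proper _ _ (mod-adjacent e∈D 0<e e+e≤n k))
           (proper _ _ (mod-adjacent e∈D 0<e e+e≤n (k + e)))))

  colour-periodic : ∀ q k → c ((k + q * (e + e)) mod n) ≡ c (k mod n)
  colour-periodic 0       k = cong (λ m → c (m mod n)) (+-identityʳ k)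
  colour-periodic (suc q) k = begin
    c ((k + (e + e + q * (e + e))) mod n) ≡⟨ cong (λ m → c (m mod n)) (+-assoc k (e + e) (q * (e + e))) ⟨
    c ((k + (e + e) + q * (e + e)) mod n) ≡⟨ colour-periodic q (k + (e + e)) ⟩
    c ((k + (e + e)) mod n)               ≡⟨ colour-return k ⟩
    c (k mod n)                           ∎
    where open ≡-Reasoning

odd-decomposition : ∀ m → ¬ 2 ∣ m → m ≡ 1 + m / 2 * 2
odd-decomposition m 2∤m = trans (m≡m%n+[m/n]*n m 2) (cong (_+ m / 2 * 2) m%2≡1)
  where
  m%2≡1 : m % 2 ≡ 1
  m%2≡1 with m % 2 | m%n<n m 2 | m%n≡0⇒n∣m m 2
  ... | 0           | _            | 2∣m = contradiction (2∣m refl) 2∤m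
  ... | 1           | _            | _   = refl
  ... | suc (suc _) | s≤s (s≤s ()) | _

-- The closed walk of f steps of length e and e steps of length f has odd length.
¬Colourable₂ : ∀ {n D e f} .{{_ : NonZero n}} →
  e ∈ D → 0 < e → e + e ≤ n → ¬ 2 ∣ e →
  f ∈ D → 0 < f → f + f ≤ n → 2 ∣ f →
  ¬ Colourable n D 2
¬Colourable₂ {n} {e = e} e∈D 0<e e+e≤n 2∤e f∈D 0<f f+f≤n (divides q refl) (c , proper) =
  proper _ _ (mod-adjacent f∈D 0<f f+f≤n 0) (begin
    c (0 mod n)                           ≡⟨ colour-periodic proper e∈D 0<e e+e≤n q 0 ⟨
    c ((q * (e + e)) mod n)               ≡⟨ cong (λ m → c (m mod n)) walks-meet ⟩
    c ((q * 2 + p * (q * 2 + q * 2)) mod n) ≡⟨ colour-periodic proper f∈D 0<f f+f≤n p (q * 2) ⟩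
    c ((q * 2) mod n)                     ∎)
  where
  open ≡-Reasoning
  p = e / 2
  walks-meet : q * (e + e) ≡ q * 2 + p * (q * 2 + q * 2)
  walks-meet = begin
    q * (e + e)                     ≡⟨ cong (λ m → q * (m + m)) (odd-decomposition e 2∤e) ⟩
    q * (1 + p * 2 + (1 + p * 2))   ≡⟨ expand p ⟩
    q * 2 + p * (q * 2 + q * 2)     ∎
    where
    expand : ∀ r → q * (1 + r * 2 + (1 + r * 2)) ≡ q * 2 + r * (q * 2 + q * 2)
    expand r = solve (q ∷ r ∷ [])

Colourable-mono : ∀ {n D m k} → m ≤ k → Colourable n D m → Colourable n D k
Colourable-mono m≤k (c , proper) =
  (λ i → inject≤ (c i) m≤k) , λ i j adj eq → proper i j adj (inject≤-injective m≤k m≤k _ _ eq)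

-- The residues at distance at least 2 from 0 in ℤ₆.
data Far₆ : ℕ → Set where
  far₂ : Far₆ 2
  far₃ : Far₆ 3
  far₄ : Far₆ 4

colour₆ : ℕ → Fin 3
colour₆ k = quotient 2 (k mod 6)

colour₆-cong : ∀ k l → k % 6 ≡ l % 6 → colour₆ k ≡ colour₆ l
colour₆-cong k l eq = cong (quotient 2) (fromℕ<-cong (k % 6) (l % 6) eq (m%n<n k 6) (m%n<n l 6))

colour₆-residue-shift : ∀ r {d} → r < 6 → Far₆ d → colour₆ r ≢ colour₆ (r + d)
colour₆-residue-shift 0 _ far₂ ()
colour₆-residue-shift 0 _ far₃ ()
colour₆-residue-shift 0 _ far₄ ()
colour₆-residue-shift 1 _ far₂ ()
colour₆-residue-shift 1 _ far₃ ()
colour₆-residue-shift 1 _ far₄ ()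
colour₆-residue-shift 2 _ far₂ ()
colour₆-residue-shift 2 _ far₃ ()
colour₆-residue-shift 2 _ far₄ ()
colour₆-residue-shift 3 _ far₂ ()
colour₆-residue-shift 3 _ far₃ ()
colour₆-residue-shift 3 _ far₄ ()
colour₆-residue-shift 4 _ far₂ ()
colour₆-residue-shift 4 _ far₃ ()
colour₆-residue-shift 4 _ far₄ ()
colour₆-residue-shift 5 _ far₂ ()
colour₆-residue-shift 5 _ far₃ ()
colour₆-residue-shift 5 _ far₄ ()
colour₆-residue-shift (suc (suc (suc (suc (suc (suc _)))))) (s≤s (s≤s (s≤s (s≤s (s≤s (s≤s ())))))) _

colour₆-shift : ∀ x {e} → Far₆ (e % 6) → colour₆ x ≢ colour₆ (x + e)
colour₆-shift x {e} far eq = colour₆-residue-shift (x % 6) (m%n<n x 6) far (begin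
  colour₆ (x % 6)           ≡⟨ colour₆-cong (x % 6) x (m%n%n≡m%n x 6) ⟩
  colour₆ x                 ≡⟨ eq ⟩
  colour₆ (x + e)           ≡⟨ colour₆-cong (x + e) (x % 6 + e % 6) (%-distribˡ-+ x e 6) ⟩
  colour₆ (x % 6 + e % 6)   ∎)
  where open ≡-Reasoning

colour₆-Step : ∀ {n e x y} → 6 ∣ n → Far₆ (e % 6) → Step n e x y → colour₆ x ≢ colour₆ y
colour₆-Step {x = x} _ far (plain refl) = colour₆-shift x far
colour₆-Step {n} {e} {x} {y} 6∣n far (wrapped x+e≡y+n) eq = colour₆-shift x far (begin
  colour₆ x       ≡⟨ eq ⟩
  colour₆ y       ≡⟨ colour₆-cong (y + n) y (%-remove-+ʳ y 6∣n) ⟨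
  colour₆ (y + n) ≡⟨ cong colour₆ x+e≡y+n ⟨
  colour₆ (x + e) ∎)
  where open ≡-Reasoning

residueColouring : ∀ n → Fin n → Fin 3
residueColouring n i = colour₆ (toℕ i)

residueColouring-proper : ∀ {n D} → 6 ∣ n → (∀ {e} → e ∈ D → Far₆ (e % 6)) →
  ProperColouring n D 3 (residueColouring n)
residueColouring-proper 6∣n far i j (_ , dist∈D) with cycDist⇒Step i j refl
... | inj₁ step = colour₆-Step 6∣n (far dist∈D) step
... | inj₂ step = colour₆-Step 6∣n (far dist∈D) step ∘ sym

Far₆-odd-multiple-of-3 : ∀ m → 3 ∣ m → ¬ 2 ∣ m → Far₆ (m % 6)
Far₆-odd-multiple-of-3 m 3∣m 2∤m = classify (m % 6) (m%n<n m 6)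
  (trans (m∣n⇒o%n%m≡o%m 3 6 m (divides 2 refl)) (n∣m⇒m%n≡0 m 3 3∣m))
  (2∤m ∘ m%n≡0⇒n∣m m 2 ∘ trans (sym (m∣n⇒o%n%m≡o%m 2 6 m (divides 3 refl))))
  where
  classify : ∀ r → r < 6 → r % 3 ≡ 0 → r % 2 ≢ 0 → Far₆ r
  classify 0 _ _  odd = contradiction refl odd
  classify 1 _ ()
  classify 2 _ ()
  classify 3 _ _  _   = far₃
  classify 4 _ ()
  classify 5 _ ()
  classify (suc (suc (suc (suc (suc (suc _)))))) (s≤s (s≤s (s≤s (s≤s (s≤s (s≤s ())))))) _

Far₆-even-non-multiple-of-3 : ∀ m → ¬ 3 ∣ m → 2 ∣ m → Far₆ (m % 6)
Far₆-even-non-multiple-of-3 m 3∤m 2∣m = classify (m % 6) (m%n<n m 6)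
  (3∤m ∘ m%n≡0⇒n∣m m 3 ∘ trans (sym (m∣n⇒o%n%m≡o%m 3 6 m (divides 2 refl))))
  (trans (m∣n⇒o%n%m≡o%m 2 6 m (divides 3 refl)) (n∣m⇒m%n≡0 m 2 2∣m))
  where
  classify : ∀ r → r < 6 → r % 3 ≢ 0 → r % 2 ≡ 0 → Far₆ r
  classify 0 _ 3∤r _  = contradiction refl 3∤r
  classify 1 _ _   ()
  classify 2 _ _   _  = far₂
  classify 3 _ 3∤r _  = contradiction refl 3∤r
  classify 4 _ _   _  = far₄
  classify 5 _ _   ()
  classify (suc (suc (suc (suc (suc (suc _)))))) (s≤s (s≤s (s≤s (s≤s (s≤s (s≤s ())))))) _

6∣2*3^u : ∀ u → 1 ≤ u → 6 ∣ 2 * 3 ^ u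
6∣2*3^u (suc u) _ = divides (3 ^ u) (trans (sym (*-assoc 2 3 (3 ^ u))) (*-comm 6 (3 ^ u)))

lemma3p3p6 : (u s t : ℕ) → 1 ≤ u →
    1 ≤ s → 2 * s ≤ 2 * 3 ^ u → 1 ≤ t → 2 * t ≤ 2 * 3 ^ u →
    3 ∣ s → ¬ (2 ∣ s) → ¬ (3 ∣ t) → 2 ∣ t →
    ChromaticNumber (2 * 3 ^ u) (s ∷ t ∷ []) 3
lemma3p3p6 u s t 1≤u 1≤s 2s≤n 1≤t 2t≤n 3∣s 2∤s 3∤t 2∣t =
  (residueColouring n , residueColouring-proper (6∣2*3^u u 1≤u)
    λ { (here refl) → Far₆-odd-multiple-of-3 s 3∣s 2∤s
      ; (there (here refl)) → Far₆-even-non-multiple-of-3 t 3∤t 2∣t }) ,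
  λ m m<3 → ¬Colourable₂ (here refl) 1≤s (double-≤ s 2s≤n) 2∤s
                         (there (here refl)) 1≤t (double-≤ t 2t≤n) 2∣t
             ∘ Colourable-mono (s≤s⁻¹ m<3)
  where
  n = 2 * 3 ^ u
  instance
    nonZero-n : NonZero n
    nonZero-n = m*n≢0 2 (3 ^ u) {{_}} {{m^n≢0 3 u}}
  double-≤ : ∀ m → 2 * m ≤ n → m + m ≤ n
  double-≤ m = subst (_≤ n) (cong (m +_) (+-identityʳ m))
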